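{- If $n\ge3$, $0\le x\le p$ and $1\le k\le n$ are integers, then $$S(Q_n\cup pK_1,k)=\sum_{i=0}^{x}\binom{x}{i}S(Q_{n+i}\cup(p-x)K_1,k).$$
   Context: All graphs are finite, simple and undirected. Two colorings (assignments of colors to vertices with adjacent vertices colored differently) are equivalent if they induce the same partition of the vertex set into color classes; $S(G,k)$ denotes the number of non-equivalent colorings of $G$ using exactly $k$ colors. For $n\ge3$, $Q_n$ is the graph obtained from the path $P_n$ on $n$ vertices by adding an edge between an end vertex $v$ of the path and the vertex at distance $2$ from $v$ on the path. $pK_1$ denotes $p$ isolated vertices and $\cup$ disjoint union. -}

module Defs where

open import Data.Nat using (ℕ; zero; suc; _+_; _∸_; _<_; _≤_; _≡ᵇ_; _<ᵇ_)
open import Data.Bool using (Bool; true; false; _∧_; _∨_; not; if_then_else_)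
open import Data.Fin using (Fin; toℕ)
open import Data.List using (List; []; _∷_; map; concatMap; length; filterᵇ; allFin)
open import Data.Bool.ListAction using (all; any)
open import Data.Vec using (Vec; []; _∷_; lookup)
open import Data.Nat.Combinatorics using (_C_)

record Graph : Set where
  field
    order : ℕ
    adj   : Fin order → Fin order → Bool
open Graph public

-- Q_n ∪ p K_1 on vertices 0 .. n+p-1: vertices 0..n-1 form the path
-- 0 - 1 - ... - (n-1), the extra edge joins the end vertex 0 to vertex 2,
-- and vertices n .. n+p-1 are isolated.
adjℕ : ℕ → ℕ → ℕ → Bool
adjℕ n i j =
  (i <ᵇ n) ∧ (j <ᵇ n) ∧
  ((suc i ≡ᵇ j) ∨ (suc j ≡ᵇ i) ∨ ((i ≡ᵇ 0) ∧ (j ≡ᵇ 2)) ∨ ((i ≡ᵇ 2) ∧ (j ≡ᵇ 0)))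

QnPlusIsolated : ℕ → ℕ → Graph
QnPlusIsolated n p = record { order = n + p ; adj = λ i j → adjℕ n (toℕ i) (toℕ j) }

allVecs : (k m : ℕ) → List (Vec (Fin k) m)
allVecs k zero    = [] ∷ []
allVecs k (suc m) = concatMap (λ x → map (x ∷_) (allVecs k m)) (allFin k)

proper : (G : Graph) {k : ℕ} → Vec (Fin k) (order G) → Bool
proper G c = all (λ i → all (λ j → not (adj G i j) ∨ not (toℕ (lookup c i) ≡ᵇ toℕ (lookup c j)))
                            (allFin (order G))) (allFin (order G))

surjective : {k m : ℕ} → Vec (Fin k) m → Bool
surjective {k} {m} c = all (λ a → any (λ i → toℕ (lookup c i) ≡ᵇ toℕ a) (allFin m)) (allFin k)

-- Canonical representative (restricted growth string): each colour is at most
-- one more than the maximum colour used earlier (first vertex gets colour 0).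
-- Each partition of the vertex set into k labelled-free classes has exactly one
-- such surjective representative, so counting these counts partitions.
canonicalFrom : {k m : ℕ} → ℕ → Vec (Fin k) m → Bool
canonicalFrom bound []      = true
canonicalFrom bound (x ∷ c) =
  (toℕ x <ᵇ suc bound) ∧ canonicalFrom (if toℕ x ≡ᵇ bound then suc bound else bound) c

canonical : {k m : ℕ} → Vec (Fin k) m → Bool
canonical = canonicalFrom 0

-- S(G,k): number of non-equivalent colourings of G with exactly k colours,
-- i.e. number of partitions of V(G) into exactly k nonempty independent sets.
S : Graph → ℕ → ℕ
S G k = length (filterᵇ (λ c → proper G c ∧ surjective c ∧ canonical c) (allVecs k (order G)))

sumTo : ℕ → (ℕ → ℕ) → ℕ
sumTo zero    f = f 0
sumTo (suc x) f = sumTo x f + f (suc x)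

{-# OPTIONS --safe #-}
-- Let u = n - 1 be the end of the path (off the chord, as n ≥ 3) and v = n the first isolated
-- vertex. Colourings of Q_n ∪ (p+1)K_1 with u and v in one class are the colourings of
-- Q_n ∪ pK_1 with v merged into u; those separating u and v are the colourings of
-- Q_{n+1} ∪ pK_1, in which v is the new end of the path. Hence
--   S(Q_n ∪ (p+1)K_1, k) = S(Q_{n+1} ∪ pK_1, k) + S(Q_n ∪ pK_1, k),
-- and unfolding this Pascal recurrence x times gives the binomial sum. Partitions are counted
-- as canonical (restricted growth) colour strings, where merging v into u is duplicating the
-- entry at position n - 1; the duplicate never opens a new class, so canonicity is kept.
module Submission where

open import Defs
open import Data.Bool using (Bool; true; false; T; _∧_; _∨_; not; if_then_else_)
open import Data.Bool.ListAction using (all; any)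
open import Data.Bool.Properties using (T-∧; T-∨; T-≡; ∧-assoc)
open import Data.Empty using (⊥-elim)
open import Data.Fin using (Fin; zero; suc; toℕ; fromℕ<)
open import Data.Fin.Properties using (toℕ-injective; toℕ-fromℕ<)
open import Data.List using (List; []; _∷_; _++_; map; concatMap; length; filterᵇ; tabulate; allFin)
open import Data.List.Properties using (filter-++; filter-≐; length-++; map-tabulate; tabulate-cong)
open import Data.Nat using (ℕ; zero; suc; _+_; _*_; _∸_; _≤_; _<_; s≤s; _≡ᵇ_; _<ᵇ_)
open import Data.Nat.Combinatorics using (_C_; nCk+nC[k+1]≡[n+1]C[k+1]; k>n⇒nCk≡0)
open import Data.Nat.ListAction using (sum)
open import Data.Nat.Properties
open import Algebra.Properties.CommutativeSemigroup +-commutativeSemigroup using (interchange; x∙yz≈y∙xz)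
open import Data.Product using (∃; _×_; _,_; proj₁; proj₂)
open import Data.Sum using (_⊎_; inj₁; inj₂)
import Data.Sum as Sum
import Data.Product as Product
open import Data.Vec using (Vec; []; _∷_; lookup)
open import Data.Vec.Membership.Propositional using (_∈_)
open import Data.Vec.Membership.Propositional.Properties using (∈-lookup)
open import Data.Vec.Relation.Unary.Any using (here; there; index)
open import Data.Vec.Relation.Unary.Any.Properties using (lookup-index)
open import Function using (_∘_; _⇔_; mk⇔; Equivalence)
open import Relation.Binary.PropositionalEquality
open import Relation.Nullary using (¬_; contradiction)
open import Relation.Nullary.Decidable using (T?)

open Equivalence using (to; from)

private
  variable
    A B : Set

count : (A → Bool) → List A → ℕ
count P xs = length (filterᵇ P xs)

count-cong : {P Q : A → Bool} → (∀ x → P x ≡ Q x) → ∀ xs → count P xs ≡ count Q xs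
count-cong {P = P} {Q} P≗Q xs = cong length
  (filter-≐ (T? ∘ P) (T? ∘ Q) ((λ {x} → subst T (P≗Q x)) , (λ {x} → subst T (sym (P≗Q x)))) xs)

count-false : (xs : List A) → count (λ _ → false) xs ≡ 0
count-false []       = refl
count-false (x ∷ xs) = count-false xs

count-split : (b P : A → Bool) → ∀ xs →
  count P xs ≡ count (λ x → b x ∧ P x) xs + count (λ x → not (b x) ∧ P x) xs
count-split b P []       = refl
count-split b P (x ∷ xs) with b x | P x
... | true  | true  = cong suc (count-split b P xs)
... | false | true  = trans (cong suc (count-split b P xs)) (sym (+-suc _ _))
... | true  | false = count-split b P xs
... | false | false = count-split b P xs

count-++ : (P : A → Bool) → ∀ xs ys → count P (xs ++ ys) ≡ count P xs + count P ys
count-++ P xs ys = trans (cong length (filter-++ (T? ∘ P) xs ys)) (length-++ (filterᵇ P xs))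

count-map : (P : A → Bool) (f : B → A) → ∀ xs → count P (map f xs) ≡ count (P ∘ f) xs
count-map P f []       = refl
count-map P f (x ∷ xs) with P (f x)
... | true  = cong suc (count-map P f xs)
... | false = count-map P f xs

count-concatMap : (P : A → Bool) (f : B → List A) → ∀ xs →
  count P (concatMap f xs) ≡ sum (map (count P ∘ f) xs)
count-concatMap P f []       = refl
count-concatMap P f (x ∷ xs) =
  trans (count-++ P (f x) (concatMap f xs)) (cong (count P (f x) +_) (count-concatMap P f xs))

sum-tabulate-cong : ∀ n {f g : Fin n → ℕ} → (∀ i → f i ≡ g i) →
  sum (tabulate f) ≡ sum (tabulate g)
sum-tabulate-cong n f≗g = cong sum (tabulate-cong {n = n} f≗g)

sum-tabulate-zero : ∀ n → sum (tabulate {n = n} (λ _ → 0)) ≡ 0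
sum-tabulate-zero zero    = refl
sum-tabulate-zero (suc n) = sum-tabulate-zero n

sum-tabulate-δ : ∀ {n} (x : Fin n) (h : Fin n → ℕ) →
  sum (tabulate (λ y → if toℕ x ≡ᵇ toℕ y then h y else 0)) ≡ h x
sum-tabulate-δ {suc n} zero    h = trans (cong (h zero +_) (sum-tabulate-zero n)) (+-identityʳ _)
sum-tabulate-δ {suc n} (suc x) h = sum-tabulate-δ x (h ∘ suc)

#Vec : (k m : ℕ) → (Vec (Fin k) m → Bool) → ℕ
#Vec k m P = count P (allVecs k m)

#Vec-cong : ∀ k m {P Q : Vec (Fin k) m → Bool} → (∀ c → P c ≡ Q c) → #Vec k m P ≡ #Vec k m Q
#Vec-cong k m P≗Q = count-cong P≗Q (allVecs k m)

#Vec-cons : ∀ k m (P : Vec (Fin k) (suc m) → Bool) →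
  #Vec k (suc m) P ≡ sum (tabulate (λ x → #Vec k m (P ∘ (x ∷_))))
#Vec-cons k m P = begin
  count P (concatMap (λ x → map (x ∷_) (allVecs k m)) (allFin k))
    ≡⟨ count-concatMap P _ (allFin k) ⟩
  sum (map (λ x → count P (map (x ∷_) (allVecs k m))) (allFin k))
    ≡⟨ cong sum (map-tabulate {n = k} (λ x → x) (λ x → count P (map (x ∷_) (allVecs k m)))) ⟩
  sum (tabulate (λ x → count P (map (x ∷_) (allVecs k m))))
    ≡⟨ sum-tabulate-cong k (λ x → count-map P (x ∷_) (allVecs k m)) ⟩
  sum (tabulate (λ x → #Vec k m (P ∘ (x ∷_)))) ∎
  where open ≡-Reasoning

#Vec-guard : ∀ k m b (P : Vec (Fin k) m → Bool) →
  #Vec k m (λ c → b ∧ P c) ≡ (if b then #Vec k m P else 0)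
#Vec-guard k m true  P = refl
#Vec-guard k m false P = count-false (allVecs k m)

#Vec-subst : ∀ k {m m′} (e : m ≡ m′) (P : Vec (Fin k) m → Bool) →
  #Vec k m P ≡ #Vec k m′ (P ∘ subst (Vec (Fin k)) (sym e))
#Vec-subst k refl P = refl

-- Colourings of different lengths are compared through colourAt; positions past the end read 0.
colourAt : ∀ {k m} → Vec (Fin k) m → ℕ → ℕ
colourAt []      i       = 0
colourAt (x ∷ c) zero    = toℕ x
colourAt (x ∷ c) (suc i) = colourAt c i

duplicate : ∀ (j : ℕ) {r} → Vec A (suc j + r) → Vec A (suc j + suc r)
duplicate zero    (x ∷ v) = x ∷ x ∷ v
duplicate (suc j) (x ∷ v) = x ∷ duplicate j v

-- duplicate j is a bijection onto the vectors whose entries j and j + 1 agree.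
#Vec-duplicate : ∀ k j r (P : Vec (Fin k) (suc j + suc r) → Bool) →
  #Vec k (suc j + suc r) (λ c → (colourAt c j ≡ᵇ colourAt c (suc j)) ∧ P c) ≡
  #Vec k (suc j + r) (P ∘ duplicate j)
#Vec-duplicate k zero r P = begin
  #Vec k (2 + r) (λ c → (colourAt c 0 ≡ᵇ colourAt c 1) ∧ P c)
    ≡⟨ #Vec-cons k (suc r) _ ⟩
  sum (tabulate (λ x → #Vec k (suc r) (λ v → (toℕ x ≡ᵇ colourAt v 0) ∧ P (x ∷ v))))
    ≡⟨ sum-tabulate-cong k (λ x → #Vec-cons k r _) ⟩
  sum (tabulate (λ x → sum (tabulate (λ y →
    #Vec k r (λ w → (toℕ x ≡ᵇ toℕ y) ∧ P (x ∷ y ∷ w))))))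
    ≡⟨ sum-tabulate-cong k (λ x → sum-tabulate-cong k (λ y → #Vec-guard k r _ _)) ⟩
  sum (tabulate (λ x → sum (tabulate (λ y →
    if toℕ x ≡ᵇ toℕ y then #Vec k r (λ w → P (x ∷ y ∷ w)) else 0))))
    ≡⟨ sum-tabulate-cong k (λ x → sum-tabulate-δ x (λ y → #Vec k r (λ w → P (x ∷ y ∷ w)))) ⟩
  sum (tabulate (λ x → #Vec k r (λ w → P (x ∷ x ∷ w))))
    ≡⟨ #Vec-cons k r _ ⟨
  #Vec k (1 + r) (P ∘ duplicate zero) ∎
  where open ≡-Reasoning
#Vec-duplicate k (suc j) r P =
  trans (#Vec-cons k (suc j + suc r) _)
        (trans (sum-tabulate-cong k (λ x → #Vec-duplicate k j r (P ∘ (x ∷_))))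
               (sym (#Vec-cons k (suc j + r) _)))

sumTo-cong : ∀ x {f g : ℕ → ℕ} → (∀ i → f i ≡ g i) → sumTo x f ≡ sumTo x g
sumTo-cong zero    f≗g = f≗g 0
sumTo-cong (suc x) f≗g = cong₂ _+_ (sumTo-cong x f≗g) (f≗g (suc x))

sumTo-+ : ∀ x (f g : ℕ → ℕ) → sumTo x (λ i → f i + g i) ≡ sumTo x f + sumTo x g
sumTo-+ zero    f g = refl
sumTo-+ (suc x) f g = trans (cong (_+ (f (suc x) + g (suc x))) (sumTo-+ x f g))
                            (interchange (sumTo x f) (sumTo x g) (f (suc x)) (g (suc x)))

sumTo-suc : ∀ x (f : ℕ → ℕ) → sumTo (suc x) f ≡ f 0 + sumTo x (f ∘ suc)
sumTo-suc zero    f = refl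
sumTo-suc (suc x) f = trans (cong (_+ f (suc (suc x))) (sumTo-suc x f)) (+-assoc (f 0) _ _)

binomialTransform : ℕ → (ℕ → ℕ) → ℕ
binomialTransform x g = sumTo x (λ i → (x C i) * g i)

binomialTransform-suc : ∀ x g →
  binomialTransform (suc x) g ≡ binomialTransform x (g ∘ suc) + binomialTransform x g
binomialTransform-suc x g = begin
  binomialTransform (suc x) g
    ≡⟨ sumTo-suc x _ ⟩
  1 * g 0 + sumTo x (λ i → (suc x C suc i) * g (suc i))
    ≡⟨ cong (1 * g 0 +_) (sumTo-cong x pascal) ⟩
  1 * g 0 + sumTo x (λ i → (x C i) * g (suc i) + (x C suc i) * g (suc i))
    ≡⟨ cong (1 * g 0 +_) (sumTo-+ x (λ i → (x C i) * g (suc i)) (λ i → (x C suc i) * g (suc i))) ⟩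
  1 * g 0 + (binomialTransform x (g ∘ suc) + upper)
    ≡⟨ x∙yz≈y∙xz (1 * g 0) (binomialTransform x (g ∘ suc)) upper ⟩
  binomialTransform x (g ∘ suc) + (1 * g 0 + upper)
    ≡⟨ cong (binomialTransform x (g ∘ suc) +_) shifted ⟩
  binomialTransform x (g ∘ suc) + binomialTransform x g ∎
  where
  open ≡-Reasoning
  upper = sumTo x (λ i → (x C suc i) * g (suc i))
  pascal : ∀ i → (suc x C suc i) * g (suc i) ≡ (x C i) * g (suc i) + (x C suc i) * g (suc i)
  pascal i = trans (cong (_* g (suc i)) (sym (nCk+nC[k+1]≡[n+1]C[k+1] x i)))
                   (*-distribʳ-+ (g (suc i)) (x C i) (x C suc i))
  shifted : 1 * g 0 + upper ≡ binomialTransform x g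
  shifted = begin
    1 * g 0 + upper
      ≡⟨ sumTo-suc x _ ⟨
    binomialTransform x g + (x C suc x) * g (suc x)
      ≡⟨ cong (λ c → binomialTransform x g + c * g (suc x)) (k>n⇒nCk≡0 (n<1+n x)) ⟩
    binomialTransform x g + 0
      ≡⟨ +-identityʳ _ ⟩
    binomialTransform x g ∎

binomialTransform-unfold : ∀ (f : ℕ → ℕ → ℕ) {m} →
  (∀ {n} q → m ≤ n → f n (suc q) ≡ f (suc n) q + f n q) →
  ∀ x {n} q → m ≤ n → f n (x + q) ≡ binomialTransform x (λ i → f (n + i) q)
binomialTransform-unfold f rec zero {n} q m≤n =
  trans (cong (λ n′ → f n′ q) (sym (+-identityʳ n))) (sym (+-identityʳ _))
binomialTransform-unfold f rec (suc x) {n} q m≤n = begin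
  f n (suc (x + q))
    ≡⟨ rec (x + q) m≤n ⟩
  f (suc n) (x + q) + f n (x + q)
    ≡⟨ cong₂ _+_ (binomialTransform-unfold f rec x q (m≤n⇒m≤1+n m≤n))
                 (binomialTransform-unfold f rec x q m≤n) ⟩
  binomialTransform x (λ i → f (suc n + i) q) + binomialTransform x (λ i → f (n + i) q)
    ≡⟨ cong (_+ binomialTransform x (λ i → f (n + i) q))
            (sumTo-cong x (λ i → cong (λ n′ → (x C i) * f n′ q) (sym (+-suc n i)))) ⟩
  binomialTransform x (λ i → f (n + suc i) q) + binomialTransform x (λ i → f (n + i) q)
    ≡⟨ binomialTransform-suc x (λ i → f (n + i) q) ⟨
  binomialTransform (suc x) (λ i → f (n + i) q) ∎
  where open ≡-Reasoning

T-injective : ∀ {x y} → T x ⇔ T y → x ≡ y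
T-injective {false} {false} _   = refl
T-injective {false} {true}  x⇔y = ⊥-elim (from x⇔y _)
T-injective {true}  {false} x⇔y = ⊥-elim (to x⇔y _)
T-injective {true}  {true}  _   = refl

T-not : ∀ {b} → T (not b) ⇔ (¬ T b)
T-not {false} = mk⇔ (λ _ ()) _
T-not {true}  = mk⇔ (λ ()) (λ h → h _)

T-not-∨-not : ∀ {a b} → T (not a ∨ not b) ⇔ (T a → ¬ T b)
T-not-∨-not {false} = mk⇔ (λ _ ()) _
T-not-∨-not {true} {false} = mk⇔ (λ _ _ ()) _
T-not-∨-not {true} {true} = mk⇔ (λ ()) (λ h → h _ _)

T-not-≡ᵇ : ∀ {m n} → T (not (m ≡ᵇ n)) ⇔ m ≢ n
T-not-≡ᵇ = mk⇔ (λ t e → to T-not t (≡⇒≡ᵇ _ _ e))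
               (λ m≢n → from T-not (m≢n ∘ ≡ᵇ⇒≡ _ _))

T-toℕ-≡ᵇ : ∀ {k} {x y : Fin k} → T (toℕ x ≡ᵇ toℕ y) ⇔ x ≡ y
T-toℕ-≡ᵇ = mk⇔ (toℕ-injective ∘ ≡ᵇ⇒≡ _ _) (≡⇒≡ᵇ _ _ ∘ cong toℕ)

T-all-tabulate : ∀ {n} (f : A → Bool) (g : Fin n → A) →
  T (all f (tabulate g)) ⇔ (∀ i → T (f (g i)))
T-all-tabulate {n = zero}  f g = mk⇔ (λ _ ()) _
T-all-tabulate {n = suc n} f g = mk⇔
  (λ h → λ { zero → proj₁ (to T-∧ h) ; (suc i) → to IH (proj₂ (to T-∧ h)) i })
  (λ h → from T-∧ (h zero , from IH (h ∘ suc)))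
  where IH = T-all-tabulate f (g ∘ suc)

T-any-tabulate : ∀ {n} (f : A → Bool) (g : Fin n → A) →
  T (any f (tabulate g)) ⇔ ∃ λ i → T (f (g i))
T-any-tabulate {n = zero}  f g = mk⇔ (λ ()) (λ { (() , _) })
T-any-tabulate {n = suc n} f g = mk⇔
  (Sum.[ (zero ,_) , Product.map suc (λ t → t) ∘ to IH ] ∘ to T-∨)
  (λ { (zero , t) → from T-∨ (inj₁ t) ; (suc i , t) → from T-∨ (inj₂ (from IH (i , t))) })
  where IH = T-any-tabulate f (g ∘ suc)

T-proper : ∀ G {k} (c : Vec (Fin k) (order G)) →
  T (proper G c) ⇔ (∀ i j → T (adj G i j) → lookup c i ≢ lookup c j)
T-proper G c = mk⇔
  (λ h i j a →
    to T-not-∨-not (to (T-all-tabulate _ _) (to (T-all-tabulate _ _) h i) j) a ∘ from T-toℕ-≡ᵇ)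
  (λ h → from (T-all-tabulate _ _) λ i → from (T-all-tabulate _ _) λ j →
    from T-not-∨-not λ a → h i j a ∘ to T-toℕ-≡ᵇ)

T-surjective : ∀ {k m} (c : Vec (Fin k) m) → T (surjective c) ⇔ (∀ a → a ∈ c)
T-surjective c = mk⇔
  (λ h a → let i , t = to (T-any-tabulate _ _) (to (T-all-tabulate _ _) h a)
           in subst (_∈ c) (to T-toℕ-≡ᵇ t) (∈-lookup i c))
  (λ h → from (T-all-tabulate _ _) λ a →
    from (T-any-tabulate _ _) (index (h a) , from T-toℕ-≡ᵇ (sym (lookup-index (h a)))))

subst-Vec-natural : ∀ {B : Set} (f : ∀ {m} → Vec A m → B) {m m′} (e : m ≡ m′) (v : Vec A m) →
  f (subst (Vec A) e v) ≡ f v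
subst-Vec-natural f refl v = refl

colourAt-lookup : ∀ {k m} (c : Vec (Fin k) m) (i : Fin m) → colourAt c (toℕ i) ≡ toℕ (lookup c i)
colourAt-lookup (x ∷ c) zero    = refl
colourAt-lookup (x ∷ c) (suc i) = colourAt-lookup c i

colourAt-duplicate : ∀ {k} j {r} (d : Vec (Fin k) (suc j + r)) i → i ≤ j →
  colourAt (duplicate j d) i ≡ colourAt d i
colourAt-duplicate zero    (x ∷ d) zero    _         = refl
colourAt-duplicate (suc j) (x ∷ d) zero    _         = refl
colourAt-duplicate (suc j) (x ∷ d) (suc i) (s≤s i≤j) = colourAt-duplicate j d i i≤j

∈-duplicate : ∀ j {r} {a : A} (d : Vec A (suc j + r)) → a ∈ duplicate j d ⇔ a ∈ d
∈-duplicate zero (x ∷ v) = mk⇔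
  (λ { (here e) → here e ; (there (here e)) → here e ; (there (there p)) → there p })
  (λ { (here e) → here e ; (there p) → there (there p) })
∈-duplicate (suc j) (x ∷ v) = mk⇔
  (λ { (here e) → here e ; (there p) → there (to (∈-duplicate j v) p) })
  (λ { (here e) → here e ; (there p) → there (from (∈-duplicate j v) p) })

surjective-duplicate : ∀ {k} j {r} (d : Vec (Fin k) (suc j + r)) →
  surjective (duplicate j d) ≡ surjective d
surjective-duplicate j d = T-injective (mk⇔
  (λ h → from (T-surjective d) λ a → to (∈-duplicate j d) (to (T-surjective (duplicate j d)) h a))
  (λ h → from (T-surjective (duplicate j d)) λ a → from (∈-duplicate j d) (to (T-surjective d) h a)))

nextBound : ℕ → ℕ → ℕ
nextBound x b = if x ≡ᵇ b then suc b else b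

≤-nextBound : ∀ x b → b ≤ nextBound x b
≤-nextBound x b with x ≡ᵇ b
... | true  = n≤1+n b
... | false = ≤-refl

n≡ᵇ1+n≡false : ∀ n → (n ≡ᵇ suc n) ≡ false
n≡ᵇ1+n≡false zero    = refl
n≡ᵇ1+n≡false (suc n) = n≡ᵇ1+n≡false n

nextBound-idem : ∀ x b → nextBound x (nextBound x b) ≡ nextBound x b
nextBound-idem x b with x ≡ᵇ b in x≡ᵇb
... | false rewrite x≡ᵇb = refl
... | true  rewrite ≡ᵇ⇒≡ x b (subst T (sym x≡ᵇb) _) | n≡ᵇ1+n≡false b = refl

canonicalFrom-duplicate : ∀ {k} j {r} b (d : Vec (Fin k) (suc j + r)) →
  canonicalFrom b (duplicate j d) ≡ canonicalFrom b d
canonicalFrom-duplicate zero b (x ∷ v) with toℕ x <ᵇ suc b in x<ᵇ1+b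
... | false = refl
... | true  = trans (cong (_∧ canonicalFrom (nextBound (toℕ x) (nextBound (toℕ x) b)) v)
                          (to T-≡ x<ᵇ1+b′))
                    (cong (λ b′ → canonicalFrom b′ v) (nextBound-idem (toℕ x) b))
  where
  x≤b = ≤-pred (<ᵇ⇒< (toℕ x) (suc b) (subst T (sym x<ᵇ1+b) _))
  x<ᵇ1+b′ = <⇒<ᵇ (s≤s (≤-trans x≤b (≤-nextBound (toℕ x) b)))
canonicalFrom-duplicate (suc j) b (x ∷ v) = cong ((toℕ x <ᵇ suc b) ∧_) (canonicalFrom-duplicate j _ v)

QEdge : ℕ → ℕ → Bool
QEdge i j = (suc i ≡ᵇ j) ∨ (suc j ≡ᵇ i) ∨ ((i ≡ᵇ 0) ∧ (j ≡ᵇ 2)) ∨ ((i ≡ᵇ 2) ∧ (j ≡ᵇ 0))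

T-adjℕ : ∀ n i j → T (adjℕ n i j) ⇔ (i < n × j < n × T (QEdge i j))
T-adjℕ n i j = mk⇔
  (λ h → let i<n , rest = to T-∧ h ; j<n , e = to T-∧ rest in <ᵇ⇒< i n i<n , <ᵇ⇒< j n j<n , e)
  (λ (i<n , j<n , e) → from T-∧ (<⇒<ᵇ i<n , from T-∧ (<⇒<ᵇ j<n , e)))

QEdge-path : ∀ j → T (QEdge j (suc j))
QEdge-path j = from T-∨ (inj₁ (≡⇒≡ᵇ j j refl))

QEdge⇒ : ∀ {i j} → T (QEdge i j) → suc i ≡ j ⊎ suc j ≡ i ⊎ (i ≡ 0 × j ≡ 2) ⊎ (i ≡ 2 × j ≡ 0)
QEdge⇒ e =
  Sum.map (≡ᵇ⇒≡ _ _) (Sum.map (≡ᵇ⇒≡ _ _) (Sum.map both both ∘ to T-∨) ∘ to T-∨) (to T-∨ e)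
  where
  both : ∀ {a b c d} → T ((a ≡ᵇ b) ∧ (c ≡ᵇ d)) → a ≡ b × c ≡ d
  both {a} {b} {c} {d} t = let t₁ , t₂ = to T-∧ t in ≡ᵇ⇒≡ a b t₁ , ≡ᵇ⇒≡ c d t₂

QEdge-beyond-chord : ∀ {i y} → 3 ≤ i → T (QEdge i y) ⊎ T (QEdge y i) → suc i ≡ y ⊎ suc y ≡ i
QEdge-beyond-chord (s≤s (s≤s (s≤s _))) (inj₁ e) with QEdge⇒ e
... | inj₁ p                   = inj₁ p
... | inj₂ (inj₁ p)            = inj₂ p
... | inj₂ (inj₂ (inj₁ (() , _)))
... | inj₂ (inj₂ (inj₂ (() , _)))
QEdge-beyond-chord (s≤s (s≤s (s≤s _))) (inj₂ e) with QEdge⇒ e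
... | inj₁ p                   = inj₂ p
... | inj₂ (inj₁ p)            = inj₁ p
... | inj₂ (inj₂ (inj₁ (_ , ())))
... | inj₂ (inj₂ (inj₂ (_ , ())))

QEdge-last : ∀ {j y} → 2 ≤ j → y < suc (suc j) →
  T (QEdge (suc j) y) ⊎ T (QEdge y (suc j)) → y ≡ j
QEdge-last {y = y} 2≤j y<2+j e with QEdge-beyond-chord {y = y} (s≤s 2≤j) e
... | inj₁ refl = contradiction y<2+j (<-irrefl refl)
... | inj₂ refl = refl

ProperOnQ : ℕ → (ℕ → ℕ) → Set
ProperOnQ n f = ∀ i j → T (adjℕ n i j) → f i ≢ f j

ProperOnQ-cong : ∀ {n f g} → (∀ i → i < n → f i ≡ g i) → ProperOnQ n f → ProperOnQ n g
ProperOnQ-cong f≗g P i j a fi≡fj =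
  let i<n , j<n , _ = to (T-adjℕ _ i j) a
  in P i j a (trans (f≗g i i<n) (trans fi≡fj (sym (f≗g j j<n))))

-- For n ≥ 3, Q_{n+1} is Q_n plus the single edge {n - 1, n}.
ProperOnQ-suc : ∀ {j f} → 2 ≤ j →
  ProperOnQ (suc (suc j)) f ⇔ (ProperOnQ (suc j) f × f j ≢ f (suc j))
ProperOnQ-suc {j} {f} 2≤j = mk⇔
  (λ P → (λ i i′ → P i i′ ∘ widen i i′)
        , P j (suc j) (from (T-adjℕ _ j (suc j)) (n≤1+n (suc j) , ≤-refl , QEdge-path j)))
  (λ (P , fj≢fsj) → extend P fj≢fsj)
  where
  widen : ∀ i i′ → T (adjℕ (suc j) i i′) → T (adjℕ (suc (suc j)) i i′)
  widen i i′ a = let i< , i′< , e = to (T-adjℕ _ i i′) a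
                 in from (T-adjℕ _ i i′) (m<n⇒m<1+n i< , m<n⇒m<1+n i′< , e)
  extend : ProperOnQ (suc j) f → f j ≢ f (suc j) → ProperOnQ (suc (suc j)) f
  extend P fj≢fsj a b adj fa≡fb with to (T-adjℕ (suc (suc j)) a b) adj
  ... | a< , b< , e with m<1+n⇒m<n∨m≡n a< | m<1+n⇒m<n∨m≡n b<
  ...   | inj₁ a<n | inj₁ b<n = P a b (from (T-adjℕ _ a b) (a<n , b<n , e)) fa≡fb
  ...   | inj₂ refl | _ = fj≢fsj (sym (trans fa≡fb (cong f (QEdge-last 2≤j b< (inj₁ e)))))
  ...   | inj₁ _ | inj₂ refl = fj≢fsj (trans (cong f (sym (QEdge-last 2≤j a< (inj₂ e)))) fa≡fb)

T-proper-Q : ∀ n p {k} (c : Vec (Fin k) (n + p)) →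
  T (proper (QnPlusIsolated n p) c) ⇔ ProperOnQ n (colourAt c)
T-proper-Q n p c = mk⇔
  (λ h i j a ci≡cj →
    let i<n , j<n , _ = to (T-adjℕ n i j) a
        i<n+p = ≤-trans i<n (m≤m+n n p) ; j<n+p = ≤-trans j<n (m≤m+n n p)
        I = fromℕ< i<n+p ; J = fromℕ< j<n+p
    in to (T-proper (QnPlusIsolated n p) c) h I J
         (subst T (sym (cong₂ (adjℕ n) (toℕ-fromℕ< i<n+p) (toℕ-fromℕ< j<n+p))) a)
         (toℕ-injective (begin
           toℕ (lookup c I)   ≡⟨ colourAt-lookup c I ⟨
           colourAt c (toℕ I) ≡⟨ cong (colourAt c) (toℕ-fromℕ< i<n+p) ⟩
           colourAt c i       ≡⟨ ci≡cj ⟩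
           colourAt c j       ≡⟨ cong (colourAt c) (toℕ-fromℕ< j<n+p) ⟨
           colourAt c (toℕ J) ≡⟨ colourAt-lookup c J ⟩
           toℕ (lookup c J)   ∎)))
  (λ P → from (T-proper (QnPlusIsolated n p) c) λ I J a cI≡cJ →
    P (toℕ I) (toℕ J) a
      (trans (colourAt-lookup c I) (trans (cong toℕ cI≡cJ) (sym (colourAt-lookup c J)))))
  where open ≡-Reasoning

proper-Q-cong : ∀ {n p p′ k} (c : Vec (Fin k) (n + p)) (c′ : Vec (Fin k) (n + p′)) →
  (∀ i → i < n → colourAt c i ≡ colourAt c′ i) →
  proper (QnPlusIsolated n p) c ≡ proper (QnPlusIsolated n p′) c′
proper-Q-cong {n} {p} {p′} c c′ c≗c′ = T-injective (mk⇔
  (from (T-proper-Q n p′ c′) ∘ ProperOnQ-cong c≗c′ ∘ to (T-proper-Q n p c))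
  (from (T-proper-Q n p c) ∘ ProperOnQ-cong (λ i i<n → sym (c≗c′ i i<n)) ∘ to (T-proper-Q n p′ c′)))

proper-Q-extend : ∀ {j p k} → 2 ≤ j →
  (c : Vec (Fin k) (suc j + suc p)) (v : Vec (Fin k) (suc (suc j) + p)) →
  (∀ i → colourAt c i ≡ colourAt v i) →
  not (colourAt c j ≡ᵇ colourAt c (suc j)) ∧ proper (QnPlusIsolated (suc j) (suc p)) c ≡
  proper (QnPlusIsolated (suc (suc j)) p) v
proper-Q-extend {j} {p} 2≤j c v c≗v = T-injective (mk⇔
  (λ h → let t₁ , t₂ = to T-∧ h in
    from (T-proper-Q (suc (suc j)) p v) (from (ProperOnQ-suc {f = colourAt v} 2≤j)
      ( ProperOnQ-cong {suc j} (λ i _ → c≗v i) (to (T-proper-Q (suc j) (suc p) c) t₂)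
      , λ e → to T-not-≡ᵇ t₁ (trans (c≗v j) (trans e (sym (c≗v (suc j))))))))
  (λ h → let P , vj≢vsj = to (ProperOnQ-suc {f = colourAt v} 2≤j) (to (T-proper-Q (suc (suc j)) p v) h)
         in
    from T-∧
      ( from T-not-≡ᵇ (λ e → vj≢vsj (trans (sym (c≗v j)) (trans e (c≗v (suc j)))))
      , from (T-proper-Q (suc j) (suc p) c) (ProperOnQ-cong {suc j} (λ i _ → sym (c≗v i)) P))))

-- S (QnPlusIsolated n p) k is definitionally #Vec k (n + p) (isCanonicalColouring n p).
isCanonicalColouring : ∀ n p {k} → Vec (Fin k) (n + p) → Bool
isCanonicalColouring n p c = proper (QnPlusIsolated n p) c ∧ surjective c ∧ canonical c

isCanonicalColouring-duplicate : ∀ j p {k} (d : Vec (Fin k) (suc j + p)) →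
  isCanonicalColouring (suc j) (suc p) (duplicate j d) ≡ isCanonicalColouring (suc j) p d
isCanonicalColouring-duplicate j p d = cong₂ _∧_
  (proper-Q-cong (duplicate j d) d (λ i i<1+j → colourAt-duplicate j d i (≤-pred i<1+j)))
  (cong₂ _∧_ (surjective-duplicate j d) (canonicalFrom-duplicate j 0 d))

isCanonicalColouring-separate : ∀ j p {k} → 2 ≤ j → (v : Vec (Fin k) (suc (suc j) + p)) →
  let c = subst (Vec (Fin k)) (sym (+-suc (suc j) p)) v in
  not (colourAt c j ≡ᵇ colourAt c (suc j)) ∧ isCanonicalColouring (suc j) (suc p) c ≡
  isCanonicalColouring (suc (suc j)) p v
isCanonicalColouring-separate j p 2≤j v = begin
  not s ∧ (proper (QnPlusIsolated (suc j) (suc p)) c ∧ surjective c ∧ canonical c)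
    ≡⟨ ∧-assoc (not s) _ _ ⟨
  (not s ∧ proper (QnPlusIsolated (suc j) (suc p)) c) ∧ surjective c ∧ canonical c
    ≡⟨ cong₂ _∧_ (proper-Q-extend 2≤j c v (λ i → natural (λ w → colourAt w i)))
                 (cong₂ _∧_ (natural surjective) (natural canonical)) ⟩
  isCanonicalColouring (suc (suc j)) p v ∎
  where
  open ≡-Reasoning
  e = sym (+-suc (suc j) p)
  c = subst (Vec _) e v
  s = colourAt c j ≡ᵇ colourAt c (suc j)
  natural : ∀ {B : Set} (f : ∀ {m} → Vec _ m → B) → f c ≡ f v
  natural f = subst-Vec-natural f e v

S-QnPlusIsolated-suc : ∀ {n} p k → 3 ≤ n →
  S (QnPlusIsolated n (suc p)) k ≡ S (QnPlusIsolated (suc n) p) k + S (QnPlusIsolated n p) k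
S-QnPlusIsolated-suc {suc j} p k (s≤s 2≤j) = begin
  #Vec k (suc j + suc p) colouring ≡⟨ count-split same colouring (allVecs k (suc j + suc p)) ⟩
  #merged + #separated             ≡⟨ +-comm #merged #separated ⟩
  #separated + #merged             ≡⟨ cong₂ _+_ separated merged ⟩
  S (QnPlusIsolated (suc (suc j)) p) k + S (QnPlusIsolated (suc j) p) k ∎
  where
  open ≡-Reasoning
  colouring = isCanonicalColouring (suc j) (suc p) {k}
  same : Vec (Fin k) (suc j + suc p) → Bool
  same c = colourAt c j ≡ᵇ colourAt c (suc j)
  #merged    = #Vec k (suc j + suc p) (λ c → same c ∧ colouring c)
  #separated = #Vec k (suc j + suc p) (λ c → not (same c) ∧ colouring c)
  merged : #merged ≡ S (QnPlusIsolated (suc j) p) k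
  merged = trans (#Vec-duplicate k j p colouring)
                 (#Vec-cong k (suc j + p) (isCanonicalColouring-duplicate j p))
  separated : #separated ≡ S (QnPlusIsolated (suc (suc j)) p) k
  separated = trans (#Vec-subst k (+-suc (suc j) p) _)
                    (#Vec-cong k (suc (suc j) + p) (isCanonicalColouring-separate j p 2≤j))

lemma21 : (n x p k : ℕ) → 3 ≤ n → x ≤ p → 1 ≤ k → k ≤ n →
    S (QnPlusIsolated n p) k ≡ sumTo x (λ i → (x C i) * S (QnPlusIsolated (n + i) (p ∸ x)) k)
lemma21 n x p k 3≤n x≤p _ _ = begin
  S (QnPlusIsolated n p) k              ≡⟨ cong (λ q → S (QnPlusIsolated n q) k) (m+[n∸m]≡n x≤p) ⟨
  S (QnPlusIsolated n (x + (p ∸ x))) k  ≡⟨ binomialTransform-unfold (λ n′ q → S (QnPlusIsolated n′ q) k)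
                                             (λ q → S-QnPlusIsolated-suc q k) x (p ∸ x) 3≤n ⟩
  binomialTransform x (λ i → S (QnPlusIsolated (n + i) (p ∸ x)) k) ∎
  where open ≡-Reasoning
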